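{- If $(K,\le,\wedge,\vee,0,1,{}^\bullet)$ is a complete coquasiintuitionistic algebra, then the lattice $(K_{\bullet\bullet},\le,\curlywedge,\vee,0,1,{}^\bullet)$ is complete, where $K_{\bullet\bullet}:=\{x^{\bullet\bullet}\mid x\in K\}$ carries the restricted order and ${}^\bullet$, join the restriction of $\vee$, and meet $\alpha\curlywedge\beta:=(\alpha\wedge\beta)^{\bullet\bullet}$.
   Context: A coquasiintuitionistic algebra is a bounded distributive lattice $(K,\le,\wedge,\vee,0,1)$ with a map ${}^\bullet:K\to K$ such that for all $x,y\in K$: $x\le y$ implies $y^\bullet\le x^\bullet$; $x^{\bullet\bullet}\le x$; $y\le x\vee x^\bullet$. It is complete if the underlying lattice is complete. -}

module Defs where

open import Level using (Level; _⊔_; suc)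
open import Data.Product using (Σ; _×_; ∃)
open import Relation.Unary using (Pred)
open import Relation.Binary.Core using (Rel)
open import Algebra.Core using (Op₁; Op₂)
open import Algebra.Definitions using (_DistributesOverˡ_)
open import Relation.Binary.Lattice.Structures using (IsBoundedLattice)

record CoQIAlgebra c ℓ₁ ℓ₂ : Set (suc (c ⊔ ℓ₁ ⊔ ℓ₂)) where
  infix  4 _≈_ _≤_
  infixr 6 _∨_
  infixr 7 _∧_
  infix  9 _•
  field
    Carrier          : Set c
    _≈_              : Rel Carrier ℓ₁
    _≤_              : Rel Carrier ℓ₂
    _∨_              : Op₂ Carrier
    _∧_              : Op₂ Carrier
    ⊤                : Carrier
    ⊥                : Carrier
    isBoundedLattice : IsBoundedLattice _≈_ _≤_ _∨_ _∧_ ⊤ ⊥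
    ∧-distribˡ-∨     : _DistributesOverˡ_ _≈_ _∧_ _∨_
    _•               : Op₁ Carrier
    •-antitone       : ∀ {x y} → x ≤ y → y • ≤ x •
    ••-deflationary  : ∀ x → (x •) • ≤ x
    ∨•-top           : ∀ x y → y ≤ x ∨ x •

  open IsBoundedLattice isBoundedLattice public

module _ {c ℓ₁ ℓ₂} (K : CoQIAlgebra c ℓ₁ ℓ₂) where
  open CoQIAlgebra K

  IsUpperBound : ∀ {p} → Pred Carrier p → Carrier → Set (c ⊔ p ⊔ ℓ₂)
  IsUpperBound S u = ∀ x → S x → x ≤ u

  IsLowerBound : ∀ {p} → Pred Carrier p → Carrier → Set (c ⊔ p ⊔ ℓ₂)
  IsLowerBound S l = ∀ x → S x → l ≤ x

  IsComplete : (p : Level) → Set (suc p ⊔ c ⊔ ℓ₂)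
  IsComplete p = (S : Pred Carrier p) →
    (Σ Carrier λ s → IsUpperBound S s × (∀ u → IsUpperBound S u → s ≤ u))
    × (Σ Carrier λ i → IsLowerBound S i × (∀ l → IsLowerBound S l → l ≤ i))

  _∈K•• : Carrier → Set (c ⊔ ℓ₁)
  a ∈K•• = Σ Carrier λ x → a ≈ (x •) •

  IsComplete•• : (p : Level) → Set (suc p ⊔ c ⊔ ℓ₁ ⊔ ℓ₂)
  IsComplete•• p = (S : Pred Carrier p) → (∀ x → S x → x ∈K••) →
    (Σ Carrier λ s → s ∈K•• × IsUpperBound S s
        × (∀ u → u ∈K•• → IsUpperBound S u → s ≤ u))
    × (Σ Carrier λ i → i ∈K•• × IsLowerBound S i
        × (∀ l → l ∈K•• → IsLowerBound S l → l ≤ i))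

-- The operator x ↦ x •• is monotone and deflationary, and on K•• it is the
-- identity up to ≤, since x •• ≤ x •••• (apply • to x ••• ≤ x •).  So the
-- supremum and infimum in K of a subset of K•• become its supremum and
-- infimum in K•• after applying ••.
module Submission where

open import Defs
open import Level using (Level; _⊔_)
open import Data.Product using (Σ; _×_; _,_)
open import Relation.Unary using (Pred)

module _ {c ℓ₁ ℓ₂} (K : CoQIAlgebra c ℓ₁ ℓ₂) where
  open CoQIAlgebra K

  ••-monotone : ∀ {x y} → x ≤ y → x • • ≤ y • •
  ••-monotone x≤y = •-antitone (•-antitone x≤y)

  ••∈K•• : ∀ x → _∈K•• K (x • •)
  ••∈K•• x = x , Eq.refl

  ∈K••⇒≤•• : ∀ {a} → _∈K•• K a → a ≤ a • •
  ∈K••⇒≤•• {a} (x , a≈x••) =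
    trans (reflexive a≈x••)
      (trans (•-antitone (••-deflationary (x •)))
             (••-monotone (reflexive (Eq.sym a≈x••))))

  Supremum•• : ∀ {p} → Pred Carrier p → Set (c ⊔ ℓ₁ ⊔ ℓ₂ ⊔ p)
  Supremum•• S = Σ Carrier λ s → _∈K•• K s × IsUpperBound K S s
    × (∀ u → _∈K•• K u → IsUpperBound K S u → s ≤ u)

  Infimum•• : ∀ {p} → Pred Carrier p → Set (c ⊔ ℓ₁ ⊔ ℓ₂ ⊔ p)
  Infimum•• S = Σ Carrier λ i → _∈K•• K i × IsLowerBound K S i
    × (∀ l → _∈K•• K l → IsLowerBound K S l → l ≤ i)

  module _ {p} {S : Pred Carrier p} (S⊆K•• : ∀ x → S x → _∈K•• K x) where

    ••-of-supremum : ∀ {s} → IsUpperBound K S s → (∀ u → IsUpperBound K S u → s ≤ u) →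
      Supremum•• S
    ••-of-supremum {s} s-ub s-least =
      s • • , ••∈K•• s
      , (λ a Sa → trans (∈K••⇒≤•• (S⊆K•• a Sa)) (••-monotone (s-ub a Sa)))
      , (λ u _ u-ub → trans (••-monotone (s-least u u-ub)) (••-deflationary u))

    ••-of-infimum : ∀ {i} → IsLowerBound K S i → (∀ l → IsLowerBound K S l → l ≤ i) →
      Infimum•• S
    ••-of-infimum {i} i-lb i-greatest =
      i • • , ••∈K•• i
      , (λ a Sa → trans (••-deflationary i) (i-lb a Sa))
      , (λ l l∈K•• l-lb → trans (∈K••⇒≤•• l∈K••) (••-monotone (i-greatest l l-lb)))

mainTheorem3 : ∀ {c ℓ₁ ℓ₂ : Level} (p : Level) (K : CoQIAlgebra c ℓ₁ ℓ₂) →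
    IsComplete K p → IsComplete•• K p
mainTheorem3 p K complete S S⊆K•• with complete S
... | (_ , s-ub , s-least) , (_ , i-lb , i-greatest) =
  ••-of-supremum K S⊆K•• s-ub s-least , ••-of-infimum K S⊆K•• i-lb i-greatest
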